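{- For all $n\ge 6$, $\beta_{0,2}(n,3)=2$. Furthermore, if $\mathcal{F}\subseteq\binom{[n]}{3}$ is an intersecting family with $\beta_{0,2}(\mathcal{F})=2$, then either $\mathcal{F}$ is (an isomorphic copy of) the Fano plane, or $\mathcal{F}$ consists of $10$ triples of some six-element set $X$, containing exactly one triple from every pair $\{T, X\setminus T\}$ of complementary $3$-subsets of $X$. In both cases the family of minimal covers of $\mathcal{F}$ equals $\mathcal{F}$.
   Context: $[n]=\{1,\dots,n\}$ and $\binom{[n]}{k}$ is the family of all $k$-subsets of $[n]$. A family $\mathcal{F}$ is intersecting if $F\cap F'\neq\emptyset$ for all $F,F'\in\mathcal{F}$. For a family $\mathcal{F}$ and disjoint sets $A,B$, let $\mathcal{F}(A,\overline{B})=\{F\in\mathcal{F}: A\subseteq F,\ B\cap F=\emptyset\}$. For $\mathcal{F}\subseteq 2^{[n]}$, $\beta_{p,q}(\mathcal{F})=\min\{|\mathcal{F}(A,\overline{B})|: |A|=p,\ |B|=q,\ A\cap B=\emptyset,\ A,B\subseteq[n]\}$, and $\beta_{p,q}(n,k)=\max\{\beta_{p,q}(\mathcal{F}): \mathcal{F}\subseteq\binom{[n]}{k},\ \mathcal{F}\text{ intersecting}\}$. A cover (transversal) of $\mathcal{F}$ is a set meeting every member of $\mathcal{F}$; a minimal cover is a cover no proper subset of which is a cover. The Fano plane is the family of $7$ triples $\{1,2,3\},\{3,4,5\},\{5,6,1\},\{2,4,6\},\{1,4,7\},\{3,6,7\},\{2,5,7\}$. -}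

module Defs where

open import Data.Bool using (Bool; true; false; if_then_else_; _∧_; not; _xor_)
open import Data.Nat using (ℕ; zero; suc; _≡ᵇ_; _⊓_)
open import Data.Fin using (Fin; #_)
open import Data.Vec using (_∷_; [])
open import Data.List using (List; []; _∷_; map; _++_; concatMap; [_])
open import Data.List.Relation.Unary.Any using (Any)
open import Data.Product using (_×_; _,_; ∃; ∃-syntax)
open import Data.Fin.Subset using (Subset; _⊆_; _∩_; _∪_; _─_; ∣_∣; Nonempty; ⁅_⁆)
open import Data.Fin.Subset.Properties using (_⊆?_; nonempty?)
open import Function using (_⇔_)
open import Function.Definitions using (Injective)
open import Relation.Nullary using (¬_; ⌊_⌋)
open import Relation.Binary.PropositionalEquality using (_≡_; _≢_)

Family : ℕ → Set
Family n = Subset n → Bool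

_∈𝓕_ : ∀ {n} → Subset n → Family n → Set
T ∈𝓕 𝓕 = 𝓕 T ≡ true

allSubsets : (n : ℕ) → List (Subset n)
allSubsets zero = [] ∷ []
allSubsets (suc n) = map (true ∷_) (allSubsets n) ++ map (false ∷_) (allSubsets n)

count : ∀ {A : Set} → (A → Bool) → List A → ℕ
count f [] = 0
count f (x ∷ xs) = if f x then suc (count f xs) else count f xs

card : ∀ {n} → Family n → ℕ
card {n} 𝓕 = count 𝓕 (allSubsets n)

Uniform : ∀ {n} → ℕ → Family n → Set
Uniform k 𝓕 = ∀ T → T ∈𝓕 𝓕 → ∣ T ∣ ≡ k

Intersecting : ∀ {n} → Family n → Set
Intersecting 𝓕 = ∀ F G → F ∈𝓕 𝓕 → G ∈𝓕 𝓕 → Nonempty (F ∩ G)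

_⊆ᵇ_ : ∀ {n} → Subset n → Subset n → Bool
A ⊆ᵇ B = ⌊ A ⊆? B ⌋

disjointᵇ : ∀ {n} → Subset n → Subset n → Bool
disjointᵇ A B = not ⌊ nonempty? (A ∩ B) ⌋

restrict : ∀ {n} → Family n → Subset n → Subset n → Family n
restrict 𝓕 A B F = 𝓕 F ∧ (A ⊆ᵇ F) ∧ disjointᵇ B F

pairs : (n p q : ℕ) → List (Subset n × Subset n)
pairs n p q =
  concatMap (λ A → concatMap (λ B →
    if (∣ A ∣ ≡ᵇ p) ∧ (∣ B ∣ ≡ᵇ q) ∧ disjointᵇ A B then [ (A , B) ] else [])
    (allSubsets n)) (allSubsets n)

-- minimum of a list of naturals (value on [] is irrelevant here: only used on nonempty lists)
minList : List ℕ → ℕ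
minList [] = 0
minList (x ∷ []) = x
minList (x ∷ y ∷ ys) = x ⊓ minList (y ∷ ys)

β : ∀ {n} → ℕ → ℕ → Family n → ℕ
β {n} p q 𝓕 = minList (map (λ { (A , B) → card (restrict 𝓕 A B) }) (pairs n p q))

-- β_{p,q}(n,k) = m  (maximum over intersecting k-uniform families on [n])
βnk≡ : (n k p q m : ℕ) → Set
βnk≡ n k p q m =
  (∃[ 𝓕 ] (Uniform k 𝓕 × Intersecting {n} 𝓕 × β p q 𝓕 ≡ m)) ×
  (∀ (𝓕 : Family n) → Uniform k 𝓕 → Intersecting 𝓕 → β p q 𝓕 Data.Nat.≤ m)

Cover : ∀ {n} → Family n → Subset n → Set
Cover 𝓕 C = ∀ F → F ∈𝓕 𝓕 → Nonempty (C ∩ F)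

MinimalCover : ∀ {n} → Family n → Subset n → Set
MinimalCover 𝓕 C = Cover 𝓕 C × (∀ C′ → C′ ⊆ C → C′ ≢ C → ¬ Cover 𝓕 C′)

-- Fano plane on points 1..7, point i encoded as Fin 7 element i-1
Triple : ℕ → Set
Triple n = Fin n × Fin n × Fin n

fanoLines : List (Triple 7)
fanoLines =
    (# 0 , # 1 , # 2) ∷ (# 2 , # 3 , # 4) ∷ (# 4 , # 5 , # 0) ∷ (# 1 , # 3 , # 5)
  ∷ (# 0 , # 3 , # 6) ∷ (# 2 , # 5 , # 6) ∷ (# 1 , # 4 , # 6) ∷ []

imageTriple : ∀ {n} → (Fin 7 → Fin n) → Triple 7 → Subset n
imageTriple σ (a , b , c) = ⁅ σ a ⁆ ∪ ⁅ σ b ⁆ ∪ ⁅ σ c ⁆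

IsFanoCopy : ∀ {n} → Family n → Set
IsFanoCopy {n} 𝓕 =
  ∃[ σ ] (Injective _≡_ _≡_ σ ×
          (∀ T → T ∈𝓕 𝓕 ⇔ Any (λ L → T ≡ imageTriple σ L) fanoLines))

IsSixType : ∀ {n} → Family n → Set
IsSixType 𝓕 =
  ∃[ X ] (∣ X ∣ ≡ 6 × card 𝓕 ≡ 10 × (∀ T → T ∈𝓕 𝓕 → T ⊆ X) ×
          (∀ T → T ⊆ X → ∣ T ∣ ≡ 3 → (𝓕 T xor 𝓕 (X ─ T)) ≡ true))

-- β₀,₂(𝓕) ≥ 2 says that any two points are avoided by two distinct members of 𝓕. Starting from a
-- single triple, this repeatedly forces further triples into 𝓕: if two members share two points, 𝓕
-- contains a copy of the ten triples `sixLines` on six points, and otherwise a copy of the Fano plane.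
-- Each forcing step is a finite statement about the configuration found so far, decided by evaluation
-- and transported to 𝓕 along the embedding of its points. In both final configurations every
-- transversal contains a line, so 𝓕 consists exactly of the lines and its minimal covers are its
-- members; moreover some pair of points is avoided by only two lines, so β₀,₂(𝓕) ≤ 2, with equality
-- for the six-point configuration.

module Submission where

open import Defs
open import Data.Bool using (Bool; true; false; T; _∧_; _∨_; not; _xor_; if_then_else_)
import Data.Bool
open import Data.Unit using (tt)
open import Data.Nat using (ℕ; zero; suc; _+_; _≤_; _<_; _≥_; _≡ᵇ_; z≤n; s≤s; s≤s⁻¹)
import Data.Nat as ℕ
open import Data.Nat.Properties
  using ( ≤-refl; ≤-trans; ≤-reflexive; ≤-antisym; <⇒≤; <⇒≱; ≤⇒≯; ≰⇒>; n<1+n; m≤n⇒m≤1+n; m≤m+n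
        ; +-suc; +-identityʳ; m⊓n≤m; m⊓n≤n; ⊓-glb; ≡ᵇ⇒≡; module ≤-Reasoning )
open import Data.Fin using (Fin; zero; suc; #_; _≟_; inject≤)
open import Data.Fin.Properties using (any?; suc-injective; inject≤-injective)
open import Data.Fin.Permutation.Components using (transpose; transpose-inverse)
open import Data.Fin.Subset
  using (Subset; inside; outside; _∈_; _∉_; _⊆_; _∩_; _∪_; _─_; ∁; ∣_∣; ⁅_⁆; ⊤; ⊥; Nonempty; Empty)
open import Data.Fin.Subset.Properties
  using ( _∈?_; _⊆?_; nonempty?; anySubset?; ⊆-antisym; ⊥⊆; ∉⊥; ∈⊤; Empty-unique; ∪-identityˡ; p─q⊆p
        ; x∈⁅x⁆; x∈⁅y⁆⇒x≡y; x∈p∪q⁻; x∈p∪q⁺; x∈p∩q⁺; x∈p∩q⁻; x∈∁p⇒x∉p; x∉p⇒x∈∁p; x∈p∧x∉q⇒x∈p─q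
        ; p⊆q⇒∣p∣≤∣q∣; p⊂q⇒∣p∣<∣q∣; ∣⁅x⁆∣≡1; ∣⊥∣≡0; ∣⊤∣≡n )
open import Data.List using (List; []; _∷_; [_]; length; map; _++_; concatMap; drop)
open import Data.List.Properties using (length-map)
open import Data.List.Membership.Propositional using (find) renaming (_∈_ to _∈ˡ_)
open import Data.List.Membership.Propositional.Properties
  using (∈-map⁺; ∈-++⁺ˡ; ∈-++⁺ʳ; ∈-concatMap⁺; ∈-concatMap⁻)
open import Data.List.Relation.Unary.Any using (Any; here; there)
import Data.List.Relation.Unary.Any as Any
import Data.List.Relation.Unary.Any.Properties as Any
open import Data.List.Relation.Unary.All using (All; []; _∷_)
import Data.List.Relation.Unary.All as All
import Data.List.Relation.Unary.All.Properties as All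
open import Data.List.Relation.Unary.All.Properties using (All¬⇒¬Any)
open import Data.List.Relation.Unary.AllPairs using (allPairs?)
open import Data.List.Relation.Unary.Unique.Propositional using (Unique; []; _∷_)
import Data.List.Relation.Unary.Unique.Propositional.Properties as Unique
open import Data.Vec using (Vec; []; _∷_; lookup; tabulate; here; there)
open import Data.Vec.Properties using (lookup∘tabulate; []=⇒lookup; lookup⇒[]=; ≡-dec)
open import Data.Vec.Relation.Unary.All using ([]; _∷_)
open import Data.Vec.Relation.Unary.AllPairs using ([]; _∷_)
open import Data.Vec.Relation.Unary.Unique.Propositional using () renaming (Unique to UniqueV)
open import Data.Vec.Relation.Unary.Unique.Propositional.Properties using (lookup-injective)
open import Data.Product using (∃; ∃₂; _×_; _,_; proj₁; proj₂)
open import Data.Sum using (_⊎_; inj₁; inj₂; [_,_]′)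
open import Function using (_∘_; _⇔_; mk⇔; Equivalence)
open import Function.Definitions using (Injective)
open import Relation.Nullary using (¬_; Dec; yes; no; does; contradiction)
open import Relation.Nullary.Decidable
  using (True; toWitness; from-yes; _×-dec_; _→-dec_; ¬?; decidable-stable; dec-true; dec-false)
open import Relation.Binary.PropositionalEquality
  using (_≡_; _≢_; refl; sym; trans; cong; cong₂; subst; subst₂; module ≡-Reasoning)

private variable
  k n : ℕ
  a b c x : Fin n
  p q : Subset n

pair : Fin n → Fin n → Subset n
pair a b = ⁅ a ⁆ ∪ ⁅ b ⁆

triple : Fin n → Fin n → Fin n → Subset n
triple a b c = ⁅ a ⁆ ∪ pair b c

∈-pair⁻ : x ∈ pair a b → x ≡ a ⊎ x ≡ b
∈-pair⁻ {a = a} {b} x∈ with x∈p∪q⁻ ⁅ a ⁆ ⁅ b ⁆ x∈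
... | inj₁ x∈a = inj₁ (x∈⁅y⁆⇒x≡y a x∈a)
... | inj₂ x∈b = inj₂ (x∈⁅y⁆⇒x≡y b x∈b)

∈-triple⁻ : x ∈ triple a b c → x ≡ a ⊎ x ≡ b ⊎ x ≡ c
∈-triple⁻ {a = a} {b} {c} x∈ with x∈p∪q⁻ ⁅ a ⁆ (pair b c) x∈
... | inj₁ x∈a = inj₁ (x∈⁅y⁆⇒x≡y a x∈a)
... | inj₂ x∈bc = inj₂ (∈-pair⁻ x∈bc)

a∈pair : a ∈ pair a b
a∈pair {a = a} = x∈p∪q⁺ (inj₁ (x∈⁅x⁆ a))

b∈pair : b ∈ pair a b
b∈pair {b = b} = x∈p∪q⁺ (inj₂ (x∈⁅x⁆ b))

a∈triple : a ∈ triple a b c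
a∈triple {a = a} = x∈p∪q⁺ (inj₁ (x∈⁅x⁆ a))

b∈triple : b ∈ triple a b c
b∈triple = x∈p∪q⁺ (inj₂ a∈pair)

c∈triple : c ∈ triple a b c
c∈triple = x∈p∪q⁺ (inj₂ b∈pair)

triple⊆ : a ∈ p → b ∈ p → c ∈ p → triple a b c ⊆ p
triple⊆ a∈p b∈p c∈p x∈ with ∈-triple⁻ x∈
... | inj₁ refl = a∈p
... | inj₂ (inj₁ refl) = b∈p
... | inj₂ (inj₂ refl) = c∈p

∣⁅x⁆∪p∣≡1+∣p∣ : ∀ (x : Fin n) p → x ∉ p → ∣ ⁅ x ⁆ ∪ p ∣ ≡ suc ∣ p ∣
∣⁅x⁆∪p∣≡1+∣p∣ zero    (inside  ∷ p) x∉p = contradiction here x∉p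
∣⁅x⁆∪p∣≡1+∣p∣ zero    (outside ∷ p) x∉p = cong (suc ∘ ∣_∣) (∪-identityˡ p)
∣⁅x⁆∪p∣≡1+∣p∣ (suc x) (inside  ∷ p) x∉p = cong suc (∣⁅x⁆∪p∣≡1+∣p∣ x p (x∉p ∘ there))
∣⁅x⁆∪p∣≡1+∣p∣ (suc x) (outside ∷ p) x∉p = ∣⁅x⁆∪p∣≡1+∣p∣ x p (x∉p ∘ there)

∣pair∣≡2 : a ≢ b → ∣ pair a b ∣ ≡ 2
∣pair∣≡2 {a = a} {b} a≢b = trans (∣⁅x⁆∪p∣≡1+∣p∣ a ⁅ b ⁆ (a≢b ∘ x∈⁅y⁆⇒x≡y b)) (cong suc (∣⁅x⁆∣≡1 b))

∣triple∣≡3 : a ≢ b → a ≢ c → b ≢ c → ∣ triple a b c ∣ ≡ 3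
∣triple∣≡3 {a = a} {b} {c} a≢b a≢c b≢c = trans (∣⁅x⁆∪p∣≡1+∣p∣ a (pair b c) a∉bc) (cong suc (∣pair∣≡2 b≢c))
  where
  a∉bc : a ∉ pair b c
  a∉bc a∈ with ∈-pair⁻ a∈
  ... | inj₁ a≡b = a≢b a≡b
  ... | inj₂ a≡c = a≢c a≡c

x∈p─q⁻ : ∀ p q → x ∈ p ─ q → x ∈ p × x ∉ q
x∈p─q⁻ p q x∈ = p─q⊆p p q x∈ , go p q x∈
  where
  go : ∀ {n} {x : Fin n} p q → x ∈ p ─ q → x ∉ q
  go (_ ∷ p) (inside  ∷ q) (there x∈) (there x∈q) = go p q x∈ x∈q
  go (_ ∷ p) (outside ∷ q) (there x∈) (there x∈q) = go p q x∈ x∈q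

infix 4 _≟ˢ_ _∈ˢ?_

_≟ˢ_ : (p q : Subset n) → Dec (p ≡ q)
_≟ˢ_ = ≡-dec Data.Bool._≟_

∃-∈-∉ : ∣ p ∣ < ∣ q ∣ → ∃ λ x → x ∈ q × x ∉ p
∃-∈-∉ {p = p} {q} ∣p∣<∣q∣ with any? (λ x → x ∈? q ×-dec ¬? (x ∈? p))
... | yes witness = witness
... | no ∄ = contradiction (p⊆q⇒∣p∣≤∣q∣ q⊆p) (<⇒≱ ∣p∣<∣q∣)
  where
  q⊆p : q ⊆ p
  q⊆p {x} x∈q = decidable-stable (x ∈? p) λ x∉p → ∄ (x , x∈q , x∉p)

⊆∧∣∣≤⇒≡ : p ⊆ q → ∣ q ∣ ≤ ∣ p ∣ → p ≡ q
⊆∧∣∣≤⇒≡ {p = p} {q} p⊆q ∣q∣≤∣p∣ = ⊆-antisym p⊆q q⊆p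
  where
  q⊆p : q ⊆ p
  q⊆p {x} x∈q = decidable-stable (x ∈? p) λ x∉p → ≤⇒≯ ∣q∣≤∣p∣ (p⊂q⇒∣p∣<∣q∣ (p⊆q , x , x∈q , x∉p))

module _ {T : Subset n} (∣T∣≡3 : ∣ T ∣ ≡ 3) where

  triple-through-pair : ∀ {c d} → c ∈ T → d ∈ T → c ≢ d → ∃ λ e → c ≢ e × d ≢ e × T ≡ triple c d e
  triple-through-pair {c} {d} c∈T d∈T c≢d
    with ∃-∈-∉ {p = pair c d} (subst₂ _<_ (sym (∣pair∣≡2 c≢d)) (sym ∣T∣≡3) (n<1+n 2))
  ... | e , e∈T , e∉cd = e , c≢e , d≢e ,
    sym (⊆∧∣∣≤⇒≡ (triple⊆ c∈T d∈T e∈T) (≤-reflexive (trans ∣T∣≡3 (sym (∣triple∣≡3 c≢d c≢e d≢e)))))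
    where
    c≢e : c ≢ e
    c≢e refl = e∉cd a∈pair
    d≢e : d ≢ e
    d≢e refl = e∉cd b∈pair

  triple-through : ∀ {c} → c ∈ T → ∃₂ λ d e → c ≢ d × c ≢ e × d ≢ e × T ≡ triple c d e
  triple-through {c} c∈T with ∃-∈-∉ {p = ⁅ c ⁆} (subst₂ _<_ (sym (∣⁅x⁆∣≡1 c)) (sym ∣T∣≡3) (s≤s (s≤s z≤n)))
  ... | d , d∈T , d∉c with triple-through-pair c∈T d∈T (λ c≡d → d∉c (subst (_∈ ⁅ c ⁆) c≡d (x∈⁅x⁆ c)))
  ... | e , c≢e , d≢e , T≡cde = d , e , (λ c≡d → d∉c (subst (_∈ ⁅ c ⁆) c≡d (x∈⁅x⁆ c))) , c≢e , d≢e , T≡cde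

∈-tabulate⁻ : ∀ {f : Fin n → Bool} → x ∈ tabulate f → f x ≡ true
∈-tabulate⁻ {x = x} {f} x∈ = trans (sym (lookup∘tabulate f x)) ([]=⇒lookup x∈)

∈-tabulate⁺ : ∀ {f : Fin n → Bool} → f x ≡ true → x ∈ tabulate f
∈-tabulate⁺ {x = x} {f} fx = lookup⇒[]= x (tabulate f) (trans (lookup∘tabulate f x) fx)

image : (Fin k → Fin n) → Subset k → Subset n
image f p = tabulate λ y → does (any? λ x → x ∈? p ×-dec f x ≟ y)

preimage : (Fin k → Fin n) → Subset n → Subset k
preimage f q = tabulate λ x → lookup q (f x)

module _ (f : Fin k → Fin n) where

  ∈-image⁻ : ∀ {y} → y ∈ image f p → ∃ λ x → x ∈ p × f x ≡ y
  ∈-image⁻ {p = p} {y} y∈ with any? (λ x → x ∈? p ×-dec f x ≟ y) | ∈-tabulate⁻ y∈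
  ... | yes witness | _ = witness

  ∈-image⁺ : x ∈ p → f x ∈ image f p
  ∈-image⁺ {x = x} {p} x∈p = ∈-tabulate⁺ (dec-true (any? λ z → z ∈? p ×-dec f z ≟ f x) (x , x∈p , refl))

  image-mono : p ⊆ q → image f p ⊆ image f q
  image-mono p⊆q y∈ with ∈-image⁻ y∈
  ... | x , x∈p , refl = ∈-image⁺ (p⊆q x∈p)

  ∈-preimage⁻ : x ∈ preimage f q → f x ∈ q
  ∈-preimage⁻ {x = x} x∈ = lookup⇒[]= (f x) _ (∈-tabulate⁻ x∈)

  ∈-preimage⁺ : f x ∈ q → x ∈ preimage f q
  ∈-preimage⁺ fx∈ = ∈-tabulate⁺ ([]=⇒lookup fx∈)

  image-preimage⊆ : image f (preimage f q) ⊆ q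
  image-preimage⊆ y∈ with ∈-image⁻ y∈
  ... | x , x∈ , refl = ∈-preimage⁻ x∈

  ⊆-preimage⇒image-⊆ : p ⊆ preimage f q → image f p ⊆ q
  ⊆-preimage⇒image-⊆ p⊆ = image-preimage⊆ ∘ image-mono p⊆

  preimage-meets : Nonempty (q ∩ image f p) → Nonempty (preimage f q ∩ p)
  preimage-meets {q = q} {p} (y , y∈) with x∈p∩q⁻ q (image f p) y∈
  ... | y∈q , y∈fp with ∈-image⁻ {p = p} y∈fp
  ... | x , x∈p , refl = x , x∈p∩q⁺ (∈-preimage⁺ y∈q , x∈p)

  image-preimage : q ⊆ image f ⊤ → image f (preimage f q) ≡ q
  image-preimage {q = q} q⊆ = ⊆-antisym image-preimage⊆ q⊆image
    where
    q⊆image : q ⊆ image f (preimage f q)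
    q⊆image y∈q with ∈-image⁻ (q⊆ y∈q)
    ... | _ , _ , refl = ∈-image⁺ (∈-preimage⁺ y∈q)

  image-triple : image f (triple a b c) ≡ triple (f a) (f b) (f c)
  image-triple {a = a} {b} {c} = ⊆-antisym forth (triple⊆ (∈-image⁺ a∈triple) (∈-image⁺ b∈triple) (∈-image⁺ c∈triple))
    where
    forth : image f (triple a b c) ⊆ triple (f a) (f b) (f c)
    forth y∈ with ∈-image⁻ y∈
    ... | x , x∈ , refl with ∈-triple⁻ x∈
    ... | inj₁ refl = a∈triple
    ... | inj₂ (inj₁ refl) = b∈triple
    ... | inj₂ (inj₂ refl) = c∈triple

image-∘ : ∀ {m} (g : Fin k → Fin m) (f : Fin m → Fin n) p → image (f ∘ g) p ≡ image f (image g p)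
image-∘ g f p = ⊆-antisym forth back
  where
  forth : image (f ∘ g) p ⊆ image f (image g p)
  forth y∈ with ∈-image⁻ (f ∘ g) y∈
  ... | x , x∈p , refl = ∈-image⁺ f (∈-image⁺ g x∈p)
  back : image f (image g p) ⊆ image (f ∘ g) p
  back y∈ with ∈-image⁻ f y∈
  ... | z , z∈ , refl with ∈-image⁻ g z∈
  ... | x , x∈p , refl = ∈-image⁺ (f ∘ g) x∈p

module _ {f : Fin k → Fin n} (f-inj : Injective _≡_ _≡_ f) where

  ∈-image-injective : f x ∈ image f p → x ∈ p
  ∈-image-injective fx∈ with ∈-image⁻ f fx∈
  ... | _ , x∈p , fx≡fy = subst (_∈ _) (f-inj fx≡fy) x∈p

  image-injective : image f p ≡ image f q → p ≡ q
  image-injective eq = ⊆-antisym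
    (λ x∈p → ∈-image-injective (subst (_ ∈_) eq (∈-image⁺ f x∈p)))
    (λ x∈q → ∈-image-injective (subst (_ ∈_) (sym eq) (∈-image⁺ f x∈q)))

  image-∁ : image f ⊤ ─ image f p ≡ image f (∁ p)
  image-∁ {p = p} = ⊆-antisym forth back
    where
    forth : image f ⊤ ─ image f p ⊆ image f (∁ p)
    forth y∈ with x∈p─q⁻ (image f ⊤) (image f p) y∈
    ... | y∈⊤ , y∉p with ∈-image⁻ f y∈⊤
    ... | x , _ , refl = ∈-image⁺ f (x∉p⇒x∈∁p (y∉p ∘ ∈-image⁺ f))
    back : image f (∁ p) ⊆ image f ⊤ ─ image f p
    back y∈ with ∈-image⁻ f y∈
    ... | x , x∈∁p , refl = x∈p∧x∉q⇒x∈p─q (∈-image⁺ f ∈⊤) (x∈∁p⇒x∉p x∈∁p ∘ ∈-image-injective)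

∣image∣≡∣∣ : ∀ {f : Fin k → Fin n} → Injective _≡_ _≡_ f → ∀ p → ∣ image f p ∣ ≡ ∣ p ∣
∣image∣≡∣∣ {n = n} {f = f} f-inj [] = trans (cong ∣_∣ (Empty-unique ∄)) (∣⊥∣≡0 n)
  where
  ∄ : Empty (image f [])
  ∄ (_ , y∈) with ∈-image⁻ f {p = []} y∈
  ... | () , _
∣image∣≡∣∣ {f = f} f-inj (outside ∷ p) =
  trans (cong ∣_∣ (⊆-antisym forth back)) (∣image∣≡∣∣ (suc-injective ∘ f-inj) p)
  where
  forth : image f (outside ∷ p) ⊆ image (f ∘ suc) p
  forth y∈ with ∈-image⁻ f {p = outside ∷ p} y∈
  ... | suc x , there x∈p , refl = ∈-image⁺ (f ∘ suc) x∈p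
  back : image (f ∘ suc) p ⊆ image f (outside ∷ p)
  back y∈ with ∈-image⁻ (f ∘ suc) y∈
  ... | x , x∈p , refl = ∈-image⁺ f {p = outside ∷ p} (there x∈p)
∣image∣≡∣∣ {f = f} f-inj (inside ∷ p) = begin
  ∣ image f (inside ∷ p) ∣            ≡⟨ cong ∣_∣ (⊆-antisym forth back) ⟩
  ∣ ⁅ f zero ⁆ ∪ image (f ∘ suc) p ∣  ≡⟨ ∣⁅x⁆∪p∣≡1+∣p∣ (f zero) _ f0∉ ⟩
  suc ∣ image (f ∘ suc) p ∣           ≡⟨ cong suc (∣image∣≡∣∣ (suc-injective ∘ f-inj) p) ⟩
  suc ∣ p ∣                           ∎
  where
  open ≡-Reasoning
  f0∉ : f zero ∉ image (f ∘ suc) p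
  f0∉ f0∈ with ∈-image⁻ (f ∘ suc) f0∈
  ... | x , _ , fx≡f0 with f-inj fx≡f0
  ... | ()
  forth : image f (inside ∷ p) ⊆ ⁅ f zero ⁆ ∪ image (f ∘ suc) p
  forth y∈ with ∈-image⁻ f {p = inside ∷ p} y∈
  ... | zero , _ , refl = x∈p∪q⁺ (inj₁ (x∈⁅x⁆ (f zero)))
  ... | suc x , there x∈p , refl = x∈p∪q⁺ (inj₂ (∈-image⁺ (f ∘ suc) x∈p))
  back : ⁅ f zero ⁆ ∪ image (f ∘ suc) p ⊆ image f (inside ∷ p)
  back y∈ with x∈p∪q⁻ ⁅ f zero ⁆ (image (f ∘ suc) p) y∈
  ... | inj₁ y∈f0 rewrite x∈⁅y⁆⇒x≡y _ y∈f0 = ∈-image⁺ f here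
  ... | inj₂ y∈ᶠ with ∈-image⁻ (f ∘ suc) y∈ᶠ
  ...   | x , x∈p , refl = ∈-image⁺ f {p = inside ∷ p} (there x∈p)

∣preimage∣≤∣∣ : ∀ {f : Fin k → Fin n} → Injective _≡_ _≡_ f → ∀ q → ∣ preimage f q ∣ ≤ ∣ q ∣
∣preimage∣≤∣∣ {f = f} f-inj q =
  subst (_≤ ∣ q ∣) (∣image∣≡∣∣ f-inj (preimage f q)) (p⊆q⇒∣p∣≤∣q∣ (image-preimage⊆ f {q = q}))

module _ {A : Set} where

  count-mono : ∀ {f g : A → Bool} xs → (∀ x → f x ≡ true → g x ≡ true) → count f xs ≤ count g xs
  count-mono [] f⇒g = z≤n
  count-mono {f} {g} (x ∷ xs) f⇒g with f x in fx | g x in gx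
  ... | true  | true  = s≤s (count-mono xs f⇒g)
  ... | true  | false = contradiction (trans (sym (f⇒g x fx)) gx) λ ()
  ... | false | true  = m≤n⇒m≤1+n (count-mono xs f⇒g)
  ... | false | false = count-mono xs f⇒g

  count-cong : ∀ {f g : A → Bool} xs → (∀ x → f x ≡ g x) → count f xs ≡ count g xs
  count-cong xs f≗g = ≤-antisym
    (count-mono xs λ x fx → trans (sym (f≗g x)) fx)
    (count-mono xs λ x gx → trans (f≗g x) gx)

  count-none : ∀ {f : A → Bool} xs → (∀ x → f x ≡ false) → count f xs ≡ 0
  count-none [] _ = refl
  count-none {f} (x ∷ xs) none rewrite none x = count-none xs none

  count-++ : ∀ (f : A → Bool) xs ys → count f (xs ++ ys) ≡ count f xs + count f ys
  count-++ f [] ys = refl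
  count-++ f (x ∷ xs) ys with f x
  ... | true  = cong suc (count-++ f xs ys)
  ... | false = count-++ f xs ys

  count-map : ∀ {B : Set} (f : A → Bool) (g : B → A) xs → count f (map g xs) ≡ count (f ∘ g) xs
  count-map f g [] = refl
  count-map f g (x ∷ xs) with f (g x)
  ... | true  = cong suc (count-map f g xs)
  ... | false = count-map f g xs

  count-∨-∧ : ∀ (f g : A → Bool) xs →
    count (λ x → f x ∨ g x) xs + count (λ x → f x ∧ g x) xs ≡ count f xs + count g xs
  count-∨-∧ f g [] = refl
  count-∨-∧ f g (x ∷ xs) with f x | g x
  ... | true  | true  = cong suc (trans (+-suc _ _) (trans (cong suc (count-∨-∧ f g xs)) (sym (+-suc _ _))))
  ... | true  | false = cong suc (count-∨-∧ f g xs)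
  ... | false | true  = trans (cong suc (count-∨-∧ f g xs)) (sym (+-suc _ _))
  ... | false | false = count-∨-∧ f g xs

  count-∨ : ∀ (f g : A → Bool) xs → count (λ x → f x ∨ g x) xs ≤ count f xs + count g xs
  count-∨ f g xs = subst (count (λ x → f x ∨ g x) xs ≤_) (count-∨-∧ f g xs) (m≤m+n _ _)

  count-∨-disjoint : ∀ (f g : A → Bool) xs → (∀ x → f x ∧ g x ≡ false) →
    count (λ x → f x ∨ g x) xs ≡ count f xs + count g xs
  count-∨-disjoint f g xs disjoint = begin
    count f∨g xs                          ≡⟨ +-identityʳ _ ⟨
    count f∨g xs + 0                      ≡⟨ cong (count f∨g xs +_) (count-none xs disjoint) ⟨
    count f∨g xs + count (λ x → f x ∧ g x) xs  ≡⟨ count-∨-∧ f g xs ⟩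
    count f xs + count g xs               ∎
    where
    open ≡-Reasoning
    f∨g : A → Bool
    f∨g x = f x ∨ g x

  count-witness : ∀ (f : A → Bool) xs → 1 ≤ count f xs → ∃ λ x → f x ≡ true
  count-witness f (x ∷ xs) 1≤ with f x in fx
  ... | true  = x , fx
  ... | false = count-witness f xs 1≤

_∈ˢ?_ : (T : Subset n) (L : List (Subset n)) → Dec (T ∈ˡ L)
T ∈ˢ? L = Any.any? (T ≟ˢ_) L

count-allSubsets : ∀ (f : Subset (suc n) → Bool) →
  count f (allSubsets (suc n)) ≡ count (f ∘ (inside ∷_)) (allSubsets n) + count (f ∘ (outside ∷_)) (allSubsets n)
count-allSubsets {n} f = trans (count-++ f (map (inside ∷_) (allSubsets n)) _)
  (cong₂ _+_ (count-map f _ (allSubsets n)) (count-map f _ (allSubsets n)))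

count-≟ : ∀ (S : Subset n) → count (λ T → does (T ≟ˢ S)) (allSubsets n) ≡ 1
count-≟ [] = refl
count-≟ {suc n} (inside ∷ S) = trans (count-allSubsets (λ T → does (T ≟ˢ (inside ∷ S))))
  (cong₂ _+_ (count-≟ S) (count-none (allSubsets n) λ _ → refl))
count-≟ {suc n} (outside ∷ S) = trans (count-allSubsets (λ T → does (T ≟ˢ (outside ∷ S))))
  (cong₂ _+_ (count-none (allSubsets n) λ _ → refl) (count-≟ S))

count-∈ˢ : ∀ (L : List (Subset n)) → Unique L → count (λ T → does (T ∈ˢ? L)) (allSubsets n) ≡ length L
count-∈ˢ {n} [] [] = count-none (allSubsets n) λ _ → refl
count-∈ˢ {n} (S ∷ L) (S∉L ∷ unique) = begin
  count (λ T → does (T ≟ˢ S) ∨ does (T ∈ˢ? L)) (allSubsets n)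
    ≡⟨ count-∨-disjoint (λ T → does (T ≟ˢ S)) (λ T → does (T ∈ˢ? L)) (allSubsets n) disjoint ⟩
  count (λ T → does (T ≟ˢ S)) (allSubsets n) + count (λ T → does (T ∈ˢ? L)) (allSubsets n)
    ≡⟨ cong₂ _+_ (count-≟ S) (count-∈ˢ L unique) ⟩
  suc (length L) ∎
  where
  open ≡-Reasoning
  disjoint : ∀ T → does (T ≟ˢ S) ∧ does (T ∈ˢ? L) ≡ false
  disjoint T with T ≟ˢ S
  ... | no _ = refl
  ... | yes refl = dec-false (S ∈ˢ? L) (All¬⇒¬Any S∉L)

from-does : ∀ {P : Set} (d : Dec P) → does d ≡ true → P
from-does (yes p) _ = p

≡does : ∀ {P : Set} {b} (d : Dec P) → (b ≡ true → P) → (P → b ≡ true) → b ≡ does d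
≡does {b = true}  (yes _) _ _ = refl
≡does {b = true}  (no ¬P) to _ = contradiction (to refl) ¬P
≡does {b = false} (yes P) _ from = from P
≡does {b = false} (no _) _ _ = refl

two⇒2≤count : ∀ {f : Subset n → Bool} {S T} → S ≢ T → f S ≡ true → f T ≡ true → 2 ≤ count f (allSubsets n)
two⇒2≤count {n} {f} {S} {T} S≢T fS fT =
  subst (_≤ count f (allSubsets n)) (count-∈ˢ (S ∷ T ∷ []) ((S≢T ∷ []) ∷ [] ∷ []))
    (count-mono (allSubsets n) λ U U∈ → case (from-does (U ∈ˢ? S ∷ T ∷ []) U∈))
  where
  case : ∀ {U} → U ∈ˡ S ∷ T ∷ [] → f U ≡ true
  case (here refl) = fS
  case (there (here refl)) = fT

2≤count⇒two : ∀ (f : Subset n → Bool) → 2 ≤ count f (allSubsets n) → ∃₂ λ S T → S ≢ T × f S ≡ true × f T ≡ true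
2≤count⇒two {n} f 2≤ with count-witness f (allSubsets n) (≤-trans (s≤s z≤n) 2≤)
... | S , fS with count-witness others (allSubsets n) 1≤others
  where
  others : Subset n → Bool
  others T = f T ∧ not (does (T ≟ˢ S))
  S-or-others : ∀ T → f T ≡ true → does (T ≟ˢ S) ∨ others T ≡ true
  S-or-others T fT with T ≟ˢ S
  ... | yes _ = refl
  ... | no _ rewrite fT = refl
  1≤others : 1 ≤ count others (allSubsets n)
  1≤others = s≤s⁻¹ (begin
    2                                                         ≤⟨ 2≤ ⟩
    count f (allSubsets n)                                    ≤⟨ count-mono (allSubsets n) S-or-others ⟩
    count (λ T → does (T ≟ˢ S) ∨ others T) (allSubsets n)     ≤⟨ count-∨ _ others (allSubsets n) ⟩
    count (λ T → does (T ≟ˢ S)) (allSubsets n) + count others (allSubsets n)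
                                                              ≡⟨ cong (_+ count others (allSubsets n)) (count-≟ S) ⟩
    suc (count others (allSubsets n))                         ∎)
    where open ≤-Reasoning
... | T , others-T with f T in fT | T ≟ˢ S | others-T
...   | true | no T≢S | _ = S , T , T≢S ∘ sym , fS , fT

∣p∣≡0⇒≡⊥ : ∣ p ∣ ≡ 0 → p ≡ ⊥
∣p∣≡0⇒≡⊥ {p = p} ∣p∣≡0 = Empty-unique λ (x , x∈p) → contradiction
  (subst₂ _≤_ (∣⁅x⁆∣≡1 x) ∣p∣≡0 (p⊆q⇒∣p∣≤∣q∣ λ y∈x → subst (_∈ p) (sym (x∈⁅y⁆⇒x≡y x y∈x)) x∈p)) λ ()

∣p∣≡2⇒pair : ∣ p ∣ ≡ 2 → ∃₂ λ a b → a ≢ b × p ≡ pair a b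
∣p∣≡2⇒pair {n} {p} ∣p∣≡2 with ∃-∈-∉ {p = ⊥} (subst₂ _<_ (sym (∣⊥∣≡0 n)) (sym ∣p∣≡2) (s≤s z≤n))
... | a , a∈p , _ with ∃-∈-∉ {p = ⁅ a ⁆} (subst₂ _<_ (sym (∣⁅x⁆∣≡1 a)) (sym ∣p∣≡2) (n<1+n 1))
... | b , b∈p , b∉a = a , b , a≢b , sym (⊆∧∣∣≤⇒≡ ab⊆p (≤-reflexive (trans ∣p∣≡2 (sym (∣pair∣≡2 a≢b)))))
  where
  a≢b : a ≢ b
  a≢b refl = b∉a (x∈⁅x⁆ a)
  ab⊆p : pair a b ⊆ p
  ab⊆p x∈ with ∈-pair⁻ x∈
  ... | inj₁ refl = a∈p
  ... | inj₂ refl = b∈p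

pair-∩-empty : a ∉ p → b ∉ p → Empty (pair a b ∩ p)
pair-∩-empty {a = a} {p} {b} a∉p b∉p (x , x∈) with x∈p∩q⁻ (pair a b) p x∈
... | x∈ab , x∈p with ∈-pair⁻ x∈ab
... | inj₁ refl = a∉p x∈p
... | inj₂ refl = b∉p x∈p

-- β₀,₂ and pairs of points avoided by two members

Avoider : Family n → Fin n → Fin n → Subset n → Set
Avoider 𝓕 a b T = T ∈𝓕 𝓕 × a ∉ T × b ∉ T

AvoidedTwice : Family n → Set
AvoidedTwice 𝓕 = ∀ {a b} → a ≢ b → ∃₂ λ T₁ T₂ → T₁ ≢ T₂ × Avoider 𝓕 a b T₁ × Avoider 𝓕 a b T₂

module _ {𝓕 : Family n} {a b : Fin n} {T : Subset n} where

  restrict-avoider⁻ : restrict 𝓕 ⊥ (pair a b) T ≡ true → Avoider 𝓕 a b T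
  restrict-avoider⁻ r with 𝓕 T | ⊥ ⊆? T | nonempty? (pair a b ∩ T) | r
  ... | true | yes _ | no ∅ | _ =
    refl , (λ a∈T → ∅ (a , x∈p∩q⁺ (a∈pair , a∈T))) , (λ b∈T → ∅ (b , x∈p∩q⁺ (b∈pair , b∈T)))

  restrict-avoider⁺ : Avoider 𝓕 a b T → restrict 𝓕 ⊥ (pair a b) T ≡ true
  restrict-avoider⁺ (T∈ , a∉T , b∉T) rewrite T∈ with ⊥ ⊆? T | nonempty? (pair a b ∩ T)
  ... | yes _   | no _   = refl
  ... | no ⊥⊈T | _      = contradiction (λ {x} → ⊥⊆ {x = x}) ⊥⊈T
  ... | yes _   | yes ne = contradiction ne (pair-∩-empty a∉T b∉T)

∈-allSubsets : ∀ (T : Subset n) → T ∈ˡ allSubsets n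
∈-allSubsets [] = here refl
∈-allSubsets (inside ∷ T) = ∈-++⁺ˡ (∈-map⁺ (inside ∷_) (∈-allSubsets T))
∈-allSubsets {suc n} (outside ∷ T) = ∈-++⁺ʳ (map (inside ∷_) (allSubsets n)) (∈-map⁺ (outside ∷_) (∈-allSubsets T))

pairs-row : Subset n → Subset n → List (Subset n × Subset n)
pairs-row A B = if (∣ A ∣ ≡ᵇ 0) ∧ (∣ B ∣ ≡ᵇ 2) ∧ disjointᵇ A B then [ (A , B) ] else []

∈-pairs : ∀ {n} {a b : Fin n} → a ≢ b → (⊥ , pair a b) ∈ˡ pairs n 0 2
∈-pairs {n} {a} {b} a≢b =
  ∈-concatMap⁺ (λ A → concatMap (pairs-row A) (allSubsets n))
    (Any.map (λ { refl → ∈-concatMap⁺ (pairs-row ⊥) (Any.map (λ { refl → selected }) (∈-allSubsets (pair a b))) })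
      (∈-allSubsets ⊥))
  where
  selected : (⊥ , pair a b) ∈ˡ pairs-row ⊥ (pair a b)
  selected rewrite ∣⊥∣≡0 n | ∣pair∣≡2 a≢b with nonempty? (⊥ ∩ pair a b)
  ... | no _ = here refl
  ... | yes (_ , x∈) = contradiction (proj₁ (x∈p∩q⁻ ⊥ (pair a b) x∈)) ∉⊥

∈-pairs⁻ : ∀ {A B : Subset n} → (A , B) ∈ˡ pairs n 0 2 → A ≡ ⊥ × ∃₂ λ a b → a ≢ b × B ≡ pair a b
∈-pairs⁻ {n} AB∈
  with Any.satisfied (∈-concatMap⁻ (λ A → concatMap (pairs-row A) (allSubsets n)) {xs = allSubsets n} AB∈)
... | A′ , AB∈′ with Any.satisfied (∈-concatMap⁻ (pairs-row A′) {xs = allSubsets n} AB∈′)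
... | B′ , AB∈″ = selected AB∈″
  where
  selected : ∀ {A B} → (A , B) ∈ˡ pairs-row A′ B′ → A ≡ ⊥ × ∃₂ λ a b → a ≢ b × B ≡ pair a b
  selected AB∈ with ∣ A′ ∣ ≡ᵇ 0 in e₀ | ∣ B′ ∣ ≡ᵇ 2 in e₂ | disjointᵇ A′ B′ | AB∈
  ... | true | true | true | here refl =
    ∣p∣≡0⇒≡⊥ (≡ᵇ⇒≡ _ 0 (subst T (sym e₀) tt)) , ∣p∣≡2⇒pair (≡ᵇ⇒≡ _ 2 (subst T (sym e₂) tt))

minList≤ : ∀ {x} xs → x ∈ˡ xs → minList xs ≤ x
minList≤ (y ∷ []) (here refl) = ≤-refl
minList≤ (y ∷ z ∷ zs) (here refl) = m⊓n≤m y _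
minList≤ (y ∷ z ∷ zs) (there x∈) = ≤-trans (m⊓n≤n y _) (minList≤ (z ∷ zs) x∈)

≤minList : ∀ {m x} xs → x ∈ˡ xs → All (m ≤_) xs → m ≤ minList xs
≤minList (y ∷ []) _ (m≤y ∷ []) = m≤y
≤minList (y ∷ z ∷ zs) _ (m≤y ∷ m≤zs) = ⊓-glb m≤y (≤minList (z ∷ zs) (here refl) m≤zs)

restrictCount : Family n → Subset n × Subset n → ℕ
restrictCount 𝓕 (A , B) = card (restrict 𝓕 A B)

module _ {𝓕 : Family n} where

  β≤avoiders : ∀ {a b : Fin n} → a ≢ b → β 0 2 𝓕 ≤ card (restrict 𝓕 ⊥ (pair a b))
  β≤avoiders a≢b = minList≤ _ (∈-map⁺ (restrictCount 𝓕) (∈-pairs a≢b))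

  2≤β⇒avoidedTwice : 2 ≤ β 0 2 𝓕 → AvoidedTwice 𝓕
  2≤β⇒avoidedTwice 2≤β a≢b with 2≤count⇒two _ (≤-trans 2≤β (β≤avoiders a≢b))
  ... | T₁ , T₂ , T₁≢T₂ , r₁ , r₂ = T₁ , T₂ , T₁≢T₂ , restrict-avoider⁻ {𝓕 = 𝓕} r₁ , restrict-avoider⁻ {𝓕 = 𝓕} r₂

  avoidedTwice⇒2≤β : ∀ {a b : Fin n} → a ≢ b → AvoidedTwice 𝓕 → 2 ≤ β 0 2 𝓕
  avoidedTwice⇒2≤β a≢b twice = ≤minList _ (∈-map⁺ (restrictCount 𝓕) (∈-pairs a≢b)) (All.map⁺ (All.tabulate each))
    where
    each : ∀ {AB} → AB ∈ˡ pairs n 0 2 → 2 ≤ restrictCount 𝓕 AB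
    each {A , B} AB∈ with ∈-pairs⁻ AB∈
    ... | refl , c , d , c≢d , refl with twice c≢d
    ... | T₁ , T₂ , T₁≢T₂ , av₁ , av₂ =
      two⇒2≤count T₁≢T₂ (restrict-avoider⁺ {𝓕 = 𝓕} av₁) (restrict-avoider⁺ {𝓕 = 𝓕} av₂)

-- Minimal covers

member⇒minimalCover : ∀ {𝓕 : Family n} → Uniform 3 𝓕 → Intersecting 𝓕 → AvoidedTwice 𝓕 →
  ∀ {T} → T ∈𝓕 𝓕 → MinimalCover 𝓕 T
member⇒minimalCover {𝓕 = 𝓕} uniform intersecting twice {T} T∈ = (λ F → intersecting T F T∈) , minimal
  where
  minimal : ∀ C → C ⊆ T → C ≢ T → ¬ Cover 𝓕 C
  minimal C C⊆T C≢T cover with ∃-∈-∉ {p = C} {q = T} (≰⇒> λ ∣T∣≤∣C∣ → C≢T (⊆∧∣∣≤⇒≡ C⊆T ∣T∣≤∣C∣))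
  ... | w , w∈T , w∉C with triple-through (uniform T T∈) w∈T
  ... | u , v , _ , _ , u≢v , refl with twice u≢v
  ... | U , _ , _ , (U∈ , u∉U , v∉U) , _ with cover U U∈
  ... | y , y∈ with x∈p∩q⁻ C U y∈
  ... | y∈C , y∈U with ∈-triple⁻ (C⊆T y∈C)
  ... | inj₁ refl = w∉C y∈C
  ... | inj₂ (inj₁ refl) = u∉U y∈U
  ... | inj₂ (inj₂ refl) = v∉U y∈U

minimalCover⇒member : ∀ {𝓕 : Family n} → Intersecting 𝓕 → (∀ {C} → Cover 𝓕 C → ∃ λ T → T ∈𝓕 𝓕 × T ⊆ C) →
  ∀ {C} → MinimalCover 𝓕 C → C ∈𝓕 𝓕
minimalCover⇒member intersecting cover⊇member {C} (cover , minimal) with cover⊇member cover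
... | T , T∈ , T⊆C with T ≟ˢ C
... | yes refl = T∈
... | no T≢C = contradiction (λ F F∈ → intersecting T F T∈ F∈) (minimal T T⊆C T≢C)

-- Forcing members inside an embedded configuration

∀-subsets? : ∀ {P : Subset k → Set} → (∀ J → Dec (P J)) → Dec (∀ J → P J)
∀-subsets? P? with anySubset? (¬? ∘ P?)
... | yes (J , ¬PJ) = no λ ∀P → ¬PJ (∀P J)
... | no ∄ = yes λ J → decidable-stable (P? J) λ ¬PJ → ∄ (J , ¬PJ)

Forces : Subset k → List (Subset k) → List (Subset k) → Set
Forces B lines candidates =
  ∀ J → Empty (B ∩ J) → All (λ L → Nonempty (J ∩ L)) lines → Any (λ C → ∣ C ∣ ≡ 3 × C ⊆ J) candidates

forces? : ∀ (B : Subset k) lines candidates → Dec (Forces B lines candidates)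
forces? B lines candidates = ∀-subsets? λ J →
  ¬? (nonempty? (B ∩ J)) →-dec All.all? (λ L → nonempty? (J ∩ L)) lines →-dec
  Any.any? (λ C → ∣ C ∣ ℕ.≟ 3 ×-dec C ⊆? J) candidates

pattern first  = here refl
pattern second = there (here refl)
pattern third  = there (there (here refl))
pattern fourth = there (there (there (here refl)))

Embedded : Family n → (Fin k → Fin n) → List (Subset k) → Set
Embedded 𝓕 p lines = All (λ L → image p L ∈𝓕 𝓕) lines

module Forcing {𝓕 : Family n} (uniform : Uniform 3 𝓕) (intersecting : Intersecting 𝓕)
               {p : Fin k → Fin n} (p-injective : Injective _≡_ _≡_ p) where

  forced : ∀ {B lines candidates} → Forces B lines candidates → Embedded 𝓕 p lines →
           ∀ {T} → T ∈𝓕 𝓕 → (∀ {x} → x ∈ B → p x ∉ T) → Any (λ C → T ≡ image p C) candidates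
  forced {B} {lines} forces lines∈ {T} T∈ avoids =
    Any.map pinned (forces (preimage p T) disjoint (All.map (preimage-meets p ∘ intersecting T _ T∈) lines∈))
    where
    disjoint : Empty (B ∩ preimage p T)
    disjoint (x , x∈) with x∈p∩q⁻ B (preimage p T) x∈
    ... | x∈B , x∈T = avoids x∈B (∈-preimage⁻ p x∈T)
    pinned : ∀ {C} → ∣ C ∣ ≡ 3 × C ⊆ preimage p T → T ≡ image p C
    pinned {C} (∣C∣≡3 , C⊆) = sym (⊆∧∣∣≤⇒≡ (⊆-preimage⇒image-⊆ p C⊆)
      (≤-reflexive (trans (uniform T T∈) (sym (trans (∣image∣≡∣∣ p-injective C) ∣C∣≡3)))))


  TwoMembersAmong : List (Subset k) → Set
  TwoMembersAmong candidates =
    ∃₂ λ C₁ C₂ → C₁ ≢ C₂ × C₁ ∈ˡ candidates × C₂ ∈ˡ candidates × image p C₁ ∈𝓕 𝓕 × image p C₂ ∈𝓕 𝓕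

  private
    avoids-pair : ∀ {i j T} → p i ∉ T → p j ∉ T → ∀ {x} → x ∈ pair i j → p x ∉ T
    avoids-pair pi∉T pj∉T x∈ with ∈-pair⁻ x∈
    ... | inj₁ refl = pi∉T
    ... | inj₂ refl = pj∉T

  module _ (twice : AvoidedTwice 𝓕) {i j : Fin k} (i≢j : i ≢ j) where

    twoForced : ∀ candidates {lines} → {True (forces? (pair i j) lines candidates)} → Embedded 𝓕 p lines →
      TwoMembersAmong candidates
    twoForced candidates {_} {certified} lines∈ with twice (i≢j ∘ p-injective)
    ... | T₁ , T₂ , T₁≢T₂ , (T₁∈ , pi∉T₁ , pj∉T₁) , (T₂∈ , pi∉T₂ , pj∉T₂)
      with find (forced (toWitness certified) lines∈ T₁∈ (avoids-pair pi∉T₁ pj∉T₁))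
         | find (forced (toWitness certified) lines∈ T₂∈ (avoids-pair pi∉T₂ pj∉T₂))
    ... | C₁ , C₁∈ , refl | C₂ , C₂∈ , refl = C₁ , C₂ , T₁≢T₂ ∘ cong (image p) , C₁∈ , C₂∈ , T₁∈ , T₂∈

    forcedBoth : ∀ A C {lines} → {True (forces? (pair i j) lines (A ∷ C ∷ []))} → Embedded 𝓕 p lines →
      image p A ∈𝓕 𝓕 × image p C ∈𝓕 𝓕
    forcedBoth A C {_} {certified} lines∈ with twoForced (A ∷ C ∷ []) {_} {certified} lines∈
    ... | _ , _ , C₁≢C₂ , first , first , _ = contradiction refl C₁≢C₂
    ... | _ , _ , _ , first , second , A∈ , C∈ = A∈ , C∈
    ... | _ , _ , _ , second , first , C∈ , A∈ = A∈ , C∈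
    ... | _ , _ , C₁≢C₂ , second , second , _ = contradiction refl C₁≢C₂

    forcedEither : ∀ A C D {lines} → {True (forces? (pair i j) lines (A ∷ C ∷ D ∷ []))} → Embedded 𝓕 p lines →
      image p A ∈𝓕 𝓕 ⊎ image p C ∈𝓕 𝓕
    forcedEither A C D {_} {certified} lines∈ with twoForced (A ∷ C ∷ D ∷ []) {_} {certified} lines∈
    ... | _ , _ , _ , first , _ , A∈ , _ = inj₁ A∈
    ... | _ , _ , _ , second , _ , C∈ , _ = inj₂ C∈
    ... | _ , _ , _ , third , first , _ , A∈ = inj₁ A∈
    ... | _ , _ , _ , third , second , _ , C∈ = inj₂ C∈
    ... | _ , _ , C₁≢C₂ , third , third , _ = contradiction refl C₁≢C₂

  forcedPair⇒β≤2 : ∀ {i j : Fin k} → i ≢ j → ∀ A C {lines} → A ≢ C → {True (forces? (pair i j) lines (A ∷ C ∷ []))} →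
        Embedded 𝓕 p lines → β 0 2 𝓕 ≤ 2
  forcedPair⇒β≤2 {i} {j} i≢j A C A≢C {certified} lines∈ = begin
    β 0 2 𝓕                                              ≤⟨ β≤avoiders {𝓕 = 𝓕} (i≢j ∘ p-injective) ⟩
    card (restrict 𝓕 ⊥ (pair (p i) (p j)))               ≤⟨ count-mono (allSubsets n) onLines ⟩
    count (λ T → does (T ∈ˢ? images)) (allSubsets n)     ≡⟨ count-∈ˢ images unique ⟩
    2                                                    ∎
    where
    open ≤-Reasoning
    images : List (Subset n)
    images = image p A ∷ image p C ∷ []
    unique : Unique images
    unique = ((A≢C ∘ image-injective p-injective) ∷ []) ∷ [] ∷ []
    onLines : ∀ T → restrict 𝓕 ⊥ (pair (p i) (p j)) T ≡ true → does (T ∈ˢ? images) ≡ true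
    onLines T r with restrict-avoider⁻ {𝓕 = 𝓕} r
    ... | T∈ , pi∉ , pj∉ =
      dec-true (T ∈ˢ? images) (Any.map⁺ (forced (toWitness certified) lines∈ T∈ (avoids-pair pi∉ pj∉)))

record Copy (𝓕 : Family n) (lines : List (Subset k)) : Set where
  field
    point : Fin k → Fin n
    point-injective : Injective _≡_ _≡_ point
    lines∈𝓕 : Embedded 𝓕 point lines

-- `Forces ⊥ lines lines`: every transversal of the configuration contains one of its lines.
module Blocking {𝓕 : Family n} (uniform : Uniform 3 𝓕) (intersecting : Intersecting 𝓕)
              {lines : List (Subset k)} (copy : Copy 𝓕 lines) (blocking : Forces ⊥ lines lines) where

  open Copy copy public
  open Forcing uniform intersecting point-injective

  ∈𝓕⇔line : ∀ T → T ∈𝓕 𝓕 ⇔ Any (λ L → T ≡ image point L) lines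
  ∈𝓕⇔line T = mk⇔ (λ T∈ → forced blocking lines∈𝓕 T∈ λ x∈⊥ → contradiction x∈⊥ ∉⊥) line⇒∈𝓕
    where
    line⇒∈𝓕 : Any (λ L → T ≡ image point L) lines → T ∈𝓕 𝓕
    line⇒∈𝓕 T≡line with find T≡line
    ... | L , L∈ , refl = All.lookup lines∈𝓕 L∈

  image∈𝓕⇔line : ∀ J → image point J ∈𝓕 𝓕 ⇔ J ∈ˡ lines
  image∈𝓕⇔line J = mk⇔
    (Any.map (image-injective point-injective) ∘ Equivalence.to (∈𝓕⇔line (image point J)))
    (Equivalence.from (∈𝓕⇔line (image point J)) ∘ Any.map (cong (image point)))

  cover⊇member : ∀ {C} → Cover 𝓕 C → ∃ λ T → T ∈𝓕 𝓕 × T ⊆ C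
  cover⊇member {C} cover with find (blocking (preimage point C) ∅ (All.map (preimage-meets point ∘ cover _) lines∈𝓕))
    where
    ∅ : Empty (⊥ ∩ preimage point C)
    ∅ (x , x∈) = ∉⊥ (proj₁ (x∈p∩q⁻ ⊥ (preimage point C) x∈))
  ... | L , L∈ , _ , L⊆ = image point L , All.lookup lines∈𝓕 L∈ , ⊆-preimage⇒image-⊆ point L⊆

  minimalCover⇔member : AvoidedTwice 𝓕 → ∀ C → MinimalCover 𝓕 C ⇔ C ∈𝓕 𝓕
  minimalCover⇔member twice C = mk⇔
    (minimalCover⇒member intersecting cover⊇member) (member⇒minimalCover uniform intersecting twice)

  𝓕-image : ∀ J → 𝓕 (image point J) ≡ does (J ∈ˢ? lines)
  𝓕-image J = ≡does (J ∈ˢ? lines) (Equivalence.to (image∈𝓕⇔line J)) (Equivalence.from (image∈𝓕⇔line J))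

  card≡length : Unique lines → card 𝓕 ≡ length lines
  card≡length unique = begin
    count 𝓕 (allSubsets n)                                           ≡⟨ count-cong (allSubsets n) 𝓕≡∈images ⟩
    count (λ T → does (T ∈ˢ? map (image point) lines)) (allSubsets n)
      ≡⟨ count-∈ˢ _ (Unique.map⁺ (image-injective point-injective) unique) ⟩
    length (map (image point) lines)                                  ≡⟨ length-map (image point) lines ⟩
    length lines                                                      ∎
    where
    open ≡-Reasoning
    𝓕≡∈images : ∀ T → 𝓕 T ≡ does (T ∈ˢ? map (image point) lines)
    𝓕≡∈images T = ≡does (T ∈ˢ? _) (Any.map⁺ ∘ Equivalence.to (∈𝓕⇔line T)) (Equivalence.from (∈𝓕⇔line T) ∘ Any.map⁻)

  member⊆image : ∀ T → T ∈𝓕 𝓕 → T ⊆ image point ⊤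
  member⊆image T T∈ with find (Equivalence.to (∈𝓕⇔line T) T∈)
  ... | L , _ , refl = image-mono point λ _ → ∈⊤

-- The six-point configuration and the Fano plane

-- Listed in reverse order of derivation: `drop k sixLines` are the lines known at the stages below.
sixLines : List (Subset 6)
sixLines =
  triple (# 0) (# 3) (# 5) ∷ triple (# 1) (# 2) (# 5) ∷ triple (# 1) (# 3) (# 4) ∷ triple (# 0) (# 2) (# 4) ∷
  triple (# 1) (# 4) (# 5) ∷ triple (# 0) (# 4) (# 5) ∷
  triple (# 2) (# 3) (# 5) ∷ triple (# 2) (# 3) (# 4) ∷ triple (# 0) (# 1) (# 3) ∷ triple (# 0) (# 1) (# 2) ∷ []

tripleOf : Triple k → Subset k
tripleOf (a , b , c) = triple a b c

fano : List (Subset 7)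
fano = map tripleOf fanoLines

SharedPair : Family n → Set
SharedPair 𝓕 = ∃₂ λ a b → a ≢ b × ∃₂ λ T₁ T₂ → T₁ ≢ T₂ × T₁ ∈𝓕 𝓕 × T₂ ∈𝓕 𝓕 × a ∈ T₁ × b ∈ T₁ × a ∈ T₂ × b ∈ T₂

sharedPair? : (𝓕 : Family n) → Dec (SharedPair 𝓕)
sharedPair? 𝓕 = any? λ a → any? λ b → ¬? (a ≟ b) ×-dec anySubset? λ T₁ → anySubset? λ T₂ →
  ¬? (T₁ ≟ˢ T₂) ×-dec 𝓕 T₁ Data.Bool.≟ true ×-dec 𝓕 T₂ Data.Bool.≟ true ×-dec
  a ∈? T₁ ×-dec b ∈? T₁ ×-dec a ∈? T₂ ×-dec b ∈? T₂

∉⇒≢ : x ∉ p → a ∈ p → x ≢ a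
∉⇒≢ x∉p a∈p refl = x∉p a∈p

transpose-injective : ∀ (i j : Fin k) → Injective _≡_ _≡_ (transpose i j)
transpose-injective i j {x} {y} eq =
  trans (sym (transpose-inverse j i)) (trans (cong (transpose j i) eq) (transpose-inverse j i))

module Derivation {𝓕 : Family n} (uniform : Uniform 3 𝓕) (intersecting : Intersecting 𝓕)
                  (twice : AvoidedTwice 𝓕) where

  ∈-third : ∀ {T a b c} → T ∈𝓕 𝓕 → triple a b c ∈𝓕 𝓕 → a ∉ T → b ∉ T → c ∈ T
  ∈-third {T} {a} {b} {c} T∈ abc∈ a∉T b∉T with intersecting T (triple a b c) T∈ abc∈
  ... | x , x∈ with x∈p∩q⁻ T (triple a b c) x∈
  ... | x∈T , x∈abc with ∈-triple⁻ x∈abc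
  ... | inj₁ refl = contradiction x∈T a∉T
  ... | inj₂ (inj₁ refl) = contradiction x∈T b∉T
  ... | inj₂ (inj₂ refl) = x∈T

  image-line : ∀ (p : Fin k → Fin n) i j l → triple (p i) (p j) (p l) ∈𝓕 𝓕 → image p (triple i j l) ∈𝓕 𝓕
  image-line p i j l = subst (_∈𝓕 𝓕) (sym (image-triple p))

  relabel : ∀ {p : Fin k → Fin n} (π : Fin k → Fin k) L → image p (image π L) ∈𝓕 𝓕 → image (p ∘ π) L ∈𝓕 𝓕
  relabel {p = p} π L = subst (_∈𝓕 𝓕) (sym (image-∘ π p L))

  sixFrom₇ : ∀ {p : Fin 6 → Fin n} → Injective _≡_ _≡_ p → Embedded 𝓕 p (drop 3 sixLines) → Copy 𝓕 sixLines
  sixFrom₇ {p} p-injective lines₇ = record { point = p ; point-injective = p-injective ; lines∈𝓕 = lines₁₀ }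
    where
    open Forcing uniform intersecting p-injective
    lines₈ : Embedded 𝓕 p (drop 2 sixLines)
    lines₈ = proj₁ (forcedBoth twice {# 0} {# 2} (λ ())
                      (triple (# 1) (# 3) (# 4)) (triple (# 1) (# 4) (# 5)) lines₇) ∷ lines₇
    lines₉ : Embedded 𝓕 p (drop 1 sixLines)
    lines₉ = proj₁ (forcedBoth twice {# 0} {# 4} (λ ())
                      (triple (# 1) (# 2) (# 5)) (triple (# 2) (# 3) (# 5)) lines₈) ∷ lines₈
    lines₁₀ : Embedded 𝓕 p sixLines
    lines₁₀ = proj₁ (forcedBoth twice {# 1} {# 4} (λ ())
                       (triple (# 0) (# 3) (# 5)) (triple (# 2) (# 3) (# 5)) lines₉) ∷ lines₉

  sixFrom₆ : ∀ {p : Fin 6 → Fin n} → Injective _≡_ _≡_ p → Embedded 𝓕 p (drop 4 sixLines) → Copy 𝓕 sixLines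
  sixFrom₆ {p} p-injective lines₆@(m145 ∷ m045 ∷ m235 ∷ m234 ∷ m013 ∷ m012 ∷ []) =
    [ (λ m024 → sixFrom₇ p-injective (m024 ∷ lines₆)) , from025 ]′
      (forcedEither twice {# 1} {# 3} (λ ())
         (triple (# 0) (# 2) (# 4)) (triple (# 0) (# 2) (# 5)) (triple (# 0) (# 4) (# 5)) lines₆)
    where
    open Forcing uniform intersecting p-injective
    π : Fin 6 → Fin 6
    π = transpose (# 4) (# 5)
    r : ∀ L → image p (image π L) ∈𝓕 𝓕 → image (p ∘ π) L ∈𝓕 𝓕
    r = relabel {p = p} π
    -- swapping 4 and 5 fixes the six known lines and turns 025 into 024
    from025 : image p (triple (# 0) (# 2) (# 5)) ∈𝓕 𝓕 → Copy 𝓕 sixLines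
    from025 m025 = sixFrom₇ {p ∘ π} (transpose-injective (# 4) (# 5) ∘ p-injective)
      (r (triple (# 0) (# 2) (# 4)) m025 ∷ r (triple (# 1) (# 4) (# 5)) m145 ∷ r (triple (# 0) (# 4) (# 5)) m045 ∷
       r (triple (# 2) (# 3) (# 5)) m234 ∷ r (triple (# 2) (# 3) (# 4)) m235 ∷
       r (triple (# 0) (# 1) (# 3)) m013 ∷ r (triple (# 0) (# 1) (# 2)) m012 ∷ [])

  sixFrom₄ : ∀ {p : Fin 6 → Fin n} → Injective _≡_ _≡_ p → Embedded 𝓕 p (drop 6 sixLines) → Copy 𝓕 sixLines
  sixFrom₄ {p} p-injective lines₄ = sixFrom₆ p-injective (proj₂ forced₂₃ ∷ proj₁ forced₂₃ ∷ lines₄)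
    where
    open Forcing uniform intersecting p-injective
    forced₂₃ : image p (triple (# 0) (# 4) (# 5)) ∈𝓕 𝓕 × image p (triple (# 1) (# 4) (# 5)) ∈𝓕 𝓕
    forced₂₃ = forcedBoth twice {# 2} {# 3} (λ ()) (triple (# 0) (# 4) (# 5)) (triple (# 1) (# 4) (# 5)) lines₄

  sixFromSharedPair : SharedPair 𝓕 → Copy 𝓕 sixLines
  sixFromSharedPair (a , b , a≢b , T₁ , T₂ , T₁≢T₂ , T₁∈ , T₂∈ , a∈T₁ , b∈T₁ , a∈T₂ , b∈T₂)
    with triple-through-pair (uniform T₁ T₁∈) a∈T₁ b∈T₁ a≢b | triple-through-pair (uniform T₂ T₂∈) a∈T₂ b∈T₂ a≢b
  ... | c , a≢c , b≢c , refl | d , a≢d , b≢d , refl with twice a≢b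
  ... | U₁ , U₂ , U₁≢U₂ , (U₁∈ , a∉U₁ , b∉U₁) , (U₂∈ , a∉U₂ , b∉U₂)
    with triple-through-pair (uniform U₁ U₁∈) (∈-third U₁∈ T₁∈ a∉U₁ b∉U₁) (∈-third U₁∈ T₂∈ a∉U₁ b∉U₁)
           (T₁≢T₂ ∘ cong (triple a b))
       | triple-through-pair (uniform U₂ U₂∈) (∈-third U₂∈ T₁∈ a∉U₂ b∉U₂) (∈-third U₂∈ T₂∈ a∉U₂ b∉U₂)
           (T₁≢T₂ ∘ cong (triple a b))
  ... | e , c≢e , d≢e , refl | f , c≢f , d≢f , refl =
    sixFrom₄ σ-injective
      (image-line σ (# 2) (# 3) (# 5) U₂∈ ∷ image-line σ (# 2) (# 3) (# 4) U₁∈ ∷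
       image-line σ (# 0) (# 1) (# 3) T₂∈ ∷ image-line σ (# 0) (# 1) (# 2) T₁∈ ∷ [])
    where
    c≢d : c ≢ d
    c≢d = T₁≢T₂ ∘ cong (triple a b)
    points : Vec (Fin n) 6
    points = a ∷ b ∷ c ∷ d ∷ e ∷ f ∷ []
    distinct : UniqueV points
    distinct = (a≢b ∷ a≢c ∷ a≢d ∷ ∉⇒≢ a∉U₁ c∈triple ∷ ∉⇒≢ a∉U₂ c∈triple ∷ []) ∷
               (b≢c ∷ b≢d ∷ ∉⇒≢ b∉U₁ c∈triple ∷ ∉⇒≢ b∉U₂ c∈triple ∷ []) ∷
               (c≢d ∷ c≢e ∷ c≢f ∷ []) ∷ (d≢e ∷ d≢f ∷ []) ∷ ((U₁≢U₂ ∘ cong (triple c d)) ∷ []) ∷ [] ∷ []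
    σ : Fin 6 → Fin n
    σ = lookup points
    σ-injective : Injective _≡_ _≡_ σ
    σ-injective = lookup-injective distinct _ _

  fanoFrom₅ : ∀ {p : Fin 7 → Fin n} → Injective _≡_ _≡_ p →
    Embedded 𝓕 p (triple (# 1) (# 4) (# 6) ∷ triple (# 1) (# 3) (# 5) ∷
                  triple (# 2) (# 5) (# 6) ∷ triple (# 2) (# 3) (# 4) ∷ triple (# 0) (# 1) (# 2) ∷ []) →
    Copy 𝓕 fano
  fanoFrom₅ {p} p-injective lines₅@(m146 ∷ m135 ∷ m256 ∷ m234 ∷ m012 ∷ []) = record
    { point = p ; point-injective = p-injective
    ; lines∈𝓕 = m012 ∷ m234 ∷ proj₂ forced₁₂ ∷ m135 ∷ proj₁ forced₁₂ ∷ m256 ∷ m146 ∷ [] }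
    where
    open Forcing uniform intersecting p-injective
    forced₁₂ : image p (triple (# 0) (# 3) (# 6)) ∈𝓕 𝓕 × image p (triple (# 0) (# 4) (# 5)) ∈𝓕 𝓕
    forced₁₂ = forcedBoth twice {# 1} {# 2} (λ ()) (triple (# 0) (# 3) (# 6)) (triple (# 0) (# 4) (# 5)) lines₅

  fanoFrom₃ : ∀ {p : Fin 7 → Fin n} → Injective _≡_ _≡_ p → ¬ SharedPair 𝓕 →
    Embedded 𝓕 p (triple (# 2) (# 5) (# 6) ∷ triple (# 2) (# 3) (# 4) ∷ triple (# 0) (# 1) (# 2) ∷ []) → Copy 𝓕 fano
  fanoFrom₃ {p} p-injective linear lines₃@(m256 ∷ m234 ∷ m012 ∷ []) =
    fromAvoiders (twoForced twice {# 0} {# 2} (λ ()) candidates lines₃)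
    where
    open Forcing uniform intersecting p-injective
    candidates : List (Subset 7)
    candidates =
      triple (# 1) (# 3) (# 5) ∷ triple (# 1) (# 3) (# 6) ∷ triple (# 1) (# 4) (# 5) ∷ triple (# 1) (# 4) (# 6) ∷ []
    π : Fin 7 → Fin 7
    π = transpose (# 5) (# 6)
    r : ∀ L → image p (image π L) ∈𝓕 𝓕 → image (p ∘ π) L ∈𝓕 𝓕
    r = relabel {p = p} π
    -- swapping 5 and 6 fixes the three known lines and turns 136, 145 into 135, 146
    fromSwapped : image p (triple (# 1) (# 3) (# 6)) ∈𝓕 𝓕 → image p (triple (# 1) (# 4) (# 5)) ∈𝓕 𝓕 → Copy 𝓕 fano
    fromSwapped m136 m145 = fanoFrom₅ {p ∘ π} (transpose-injective (# 5) (# 6) ∘ p-injective)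
      (r (triple (# 1) (# 4) (# 6)) m145 ∷ r (triple (# 1) (# 3) (# 5)) m136 ∷ r (triple (# 2) (# 5) (# 6)) m256 ∷
       r (triple (# 2) (# 3) (# 4)) m234 ∷ r (triple (# 0) (# 1) (# 2)) m012 ∷ [])
    shared : ∀ {C₁ C₂} i j → i ≢ j → C₁ ≢ C₂ → {True (i ∈? C₁ ×-dec j ∈? C₁ ×-dec i ∈? C₂ ×-dec j ∈? C₂)} →
             image p C₁ ∈𝓕 𝓕 → image p C₂ ∈𝓕 𝓕 → SharedPair 𝓕
    shared i j i≢j C₁≢C₂ {both} C₁∈ C₂∈ with toWitness both
    ... | i∈C₁ , j∈C₁ , i∈C₂ , j∈C₂ =
      p i , p j , i≢j ∘ p-injective , _ , _ , C₁≢C₂ ∘ image-injective p-injective , C₁∈ , C₂∈ ,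
      ∈-image⁺ p i∈C₁ , ∈-image⁺ p j∈C₁ , ∈-image⁺ p i∈C₂ , ∈-image⁺ p j∈C₂
    -- both avoiders of 0 and 2 contain 1, and by linearity they share no other point
    fromAvoiders : TwoMembersAmong candidates → Copy 𝓕 fano
    fromAvoiders (_ , _ , C₁≢C₂ , first , first , _) = contradiction refl C₁≢C₂
    fromAvoiders (_ , _ , C₁≢C₂ , second , second , _) = contradiction refl C₁≢C₂
    fromAvoiders (_ , _ , C₁≢C₂ , third , third , _) = contradiction refl C₁≢C₂
    fromAvoiders (_ , _ , C₁≢C₂ , fourth , fourth , _) = contradiction refl C₁≢C₂
    fromAvoiders (_ , _ , _ , first , fourth , m135 , m146) = fanoFrom₅ p-injective (m146 ∷ m135 ∷ lines₃)
    fromAvoiders (_ , _ , _ , fourth , first , m146 , m135) = fanoFrom₅ p-injective (m146 ∷ m135 ∷ lines₃)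
    fromAvoiders (_ , _ , _ , second , third , m136 , m145) = fromSwapped m136 m145
    fromAvoiders (_ , _ , _ , third , second , m145 , m136) = fromSwapped m136 m145
    fromAvoiders (_ , _ , ne , first , second , m₁ , m₂) = contradiction (shared (# 1) (# 3) (λ ()) ne m₁ m₂) linear
    fromAvoiders (_ , _ , ne , second , first , m₁ , m₂) = contradiction (shared (# 1) (# 3) (λ ()) ne m₁ m₂) linear
    fromAvoiders (_ , _ , ne , first , third , m₁ , m₂) = contradiction (shared (# 1) (# 5) (λ ()) ne m₁ m₂) linear
    fromAvoiders (_ , _ , ne , third , first , m₁ , m₂) = contradiction (shared (# 1) (# 5) (λ ()) ne m₁ m₂) linear
    fromAvoiders (_ , _ , ne , second , fourth , m₁ , m₂) = contradiction (shared (# 1) (# 6) (λ ()) ne m₁ m₂) linear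
    fromAvoiders (_ , _ , ne , fourth , second , m₁ , m₂) = contradiction (shared (# 1) (# 6) (λ ()) ne m₁ m₂) linear
    fromAvoiders (_ , _ , ne , third , fourth , m₁ , m₂) = contradiction (shared (# 1) (# 4) (λ ()) ne m₁ m₂) linear
    fromAvoiders (_ , _ , ne , fourth , third , m₁ , m₂) = contradiction (shared (# 1) (# 4) (λ ()) ne m₁ m₂) linear

  fanoFromLinear : ¬ SharedPair 𝓕 → ∀ {z₀ z₁ : Fin n} → z₀ ≢ z₁ → Copy 𝓕 fano
  fanoFromLinear linear z₀≢z₁ with twice z₀≢z₁
  ... | T₀ , _ , _ , (T₀∈ , _) , _
    with ∃-∈-∉ {p = ⊥} {q = T₀} (subst₂ _<_ (sym (∣⊥∣≡0 n)) (sym (uniform T₀ T₀∈)) (s≤s z≤n))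
  ... | a , a∈T₀ , _ with triple-through (uniform T₀ T₀∈) a∈T₀
  ... | b , c , a≢b , a≢c , b≢c , refl with twice a≢b
  ... | U₁ , U₂ , U₁≢U₂ , (U₁∈ , a∉U₁ , b∉U₁) , (U₂∈ , a∉U₂ , b∉U₂)
    with triple-through (uniform U₁ U₁∈) (∈-third U₁∈ T₀∈ a∉U₁ b∉U₁)
       | triple-through (uniform U₂ U₂∈) (∈-third U₂∈ T₀∈ a∉U₂ b∉U₂)
  ... | d , e , c≢d , c≢e , d≢e , refl | f , g , c≢f , c≢g , f≢g , refl =
    fanoFrom₃ σ-injective linear
      (image-line σ (# 2) (# 5) (# 6) U₂∈ ∷ image-line σ (# 2) (# 3) (# 4) U₁∈ ∷
       image-line σ (# 0) (# 1) (# 2) T₀∈ ∷ [])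
    where
    -- U₁ and U₂ already share c, so linearity keeps d and e out of U₂
    ∉U₂ : ∀ {x} → c ≢ x → x ∈ triple c d e → x ∉ triple c f g
    ∉U₂ c≢x x∈U₁ x∈U₂ = linear (c , _ , c≢x , _ , _ , U₁≢U₂ , U₁∈ , U₂∈ , a∈triple , x∈U₁ , a∈triple , x∈U₂)
    d∉U₂ : d ∉ triple c f g
    d∉U₂ = ∉U₂ c≢d b∈triple
    e∉U₂ : e ∉ triple c f g
    e∉U₂ = ∉U₂ c≢e c∈triple
    points : Vec (Fin n) 7
    points = a ∷ b ∷ c ∷ d ∷ e ∷ f ∷ g ∷ []
    distinct : UniqueV points
    distinct =
      (a≢b ∷ a≢c ∷ ∉⇒≢ a∉U₁ b∈triple ∷ ∉⇒≢ a∉U₁ c∈triple ∷ ∉⇒≢ a∉U₂ b∈triple ∷ ∉⇒≢ a∉U₂ c∈triple ∷ []) ∷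
      (b≢c ∷ ∉⇒≢ b∉U₁ b∈triple ∷ ∉⇒≢ b∉U₁ c∈triple ∷ ∉⇒≢ b∉U₂ b∈triple ∷ ∉⇒≢ b∉U₂ c∈triple ∷ []) ∷
      (c≢d ∷ c≢e ∷ c≢f ∷ c≢g ∷ []) ∷
      (d≢e ∷ ∉⇒≢ d∉U₂ b∈triple ∷ ∉⇒≢ d∉U₂ c∈triple ∷ []) ∷
      (∉⇒≢ e∉U₂ b∈triple ∷ ∉⇒≢ e∉U₂ c∈triple ∷ []) ∷
      (f≢g ∷ []) ∷ [] ∷ []
    σ : Fin 7 → Fin n
    σ = lookup points
    σ-injective : Injective _≡_ _≡_ σ
    σ-injective = lookup-injective distinct _ _

  sixOrFano : ∀ {z₀ z₁ : Fin n} → z₀ ≢ z₁ → Copy 𝓕 sixLines ⊎ Copy 𝓕 fano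
  sixOrFano z₀≢z₁ with sharedPair? 𝓕
  ... | yes shared = inj₁ (sixFromSharedPair shared)
  ... | no linear = inj₂ (fanoFromLinear linear z₀≢z₁)

-- Decided by evaluation, and opaque so that using them never unfolds the decision procedures.
opaque
  sixBlocking : Forces ⊥ sixLines sixLines
  sixBlocking = from-yes (forces? ⊥ sixLines sixLines)

  fanoBlocking : Forces ⊥ fano fano
  fanoBlocking = from-yes (forces? ⊥ fano fano)

  sixUnique : Unique sixLines
  sixUnique = from-yes (allPairs? (λ L₁ L₂ → ¬? (L₁ ≟ˢ L₂)) sixLines)

  sixComplementary : ∀ J → ∣ J ∣ ≡ 3 → does (J ∈ˢ? sixLines) xor does (∁ J ∈ˢ? sixLines) ≡ true
  sixComplementary = from-yes (∀-subsets? λ J →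
    ∣ J ∣ ℕ.≟ 3 →-dec does (J ∈ˢ? sixLines) xor does (∁ J ∈ˢ? sixLines) Data.Bool.≟ true)

  sixTriples : All (λ L → ∣ L ∣ ≡ 3) sixLines
  sixTriples = from-yes (All.all? (λ L → ∣ L ∣ ℕ.≟ 3) sixLines)

  sixIntersecting : All (λ L₁ → All (λ L₂ → Nonempty (L₁ ∩ L₂)) sixLines) sixLines
  sixIntersecting = from-yes (All.all? (λ L₁ → All.all? (λ L₂ → nonempty? (L₁ ∩ L₂)) sixLines) sixLines)

  sixAvoidedTwice : ∀ B → ∣ B ∣ ≤ 2 →
    Any (λ L₁ → Any (λ L₂ → L₁ ≢ L₂ × Empty (B ∩ L₁) × Empty (B ∩ L₂)) sixLines) sixLines
  sixAvoidedTwice = from-yes (∀-subsets? λ B → ∣ B ∣ ℕ.≤? 2 →-dec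
    Any.any? (λ L₁ → Any.any? (λ L₂ →
      ¬? (L₁ ≟ˢ L₂) ×-dec ¬? (nonempty? (B ∩ L₁)) ×-dec ¬? (nonempty? (B ∩ L₂))) sixLines) sixLines)

module _ {𝓕 : Family n} (uniform : Uniform 3 𝓕) (intersecting : Intersecting 𝓕) where

  isSixType : Copy 𝓕 sixLines → IsSixType 𝓕
  isSixType copy = X , ∣X∣≡6 , card≡length sixUnique , member⊆image , complementary
    where
    open Blocking uniform intersecting copy sixBlocking
    X : Subset n
    X = image point ⊤
    ∣X∣≡6 : ∣ X ∣ ≡ 6
    ∣X∣≡6 = trans (∣image∣≡∣∣ point-injective ⊤) (∣⊤∣≡n 6)
    complementary : ∀ T → T ⊆ X → ∣ T ∣ ≡ 3 → 𝓕 T xor 𝓕 (X ─ T) ≡ true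
    complementary T T⊆X ∣T∣≡3 = begin
      𝓕 T xor 𝓕 (X ─ T)                                       ≡⟨ cong (λ S → 𝓕 S xor 𝓕 (X ─ S)) (sym imageJ≡T) ⟩
      𝓕 (image point J) xor 𝓕 (X ─ image point J)
        ≡⟨ cong (λ S → 𝓕 (image point J) xor 𝓕 S) (image-∁ point-injective {p = J}) ⟩
      𝓕 (image point J) xor 𝓕 (image point (∁ J))             ≡⟨ cong₂ _xor_ (𝓕-image J) (𝓕-image (∁ J)) ⟩
      does (J ∈ˢ? sixLines) xor does (∁ J ∈ˢ? sixLines)        ≡⟨ sixComplementary J ∣J∣≡3 ⟩
      true                                                     ∎
      where
      open ≡-Reasoning
      J : Subset 6
      J = preimage point T
      imageJ≡T : image point J ≡ T
      imageJ≡T = image-preimage point T⊆X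
      ∣J∣≡3 : ∣ J ∣ ≡ 3
      ∣J∣≡3 = trans (sym (∣image∣≡∣∣ point-injective J)) (trans (cong ∣_∣ imageJ≡T) ∣T∣≡3)

  isFanoCopy : Copy 𝓕 fano → IsFanoCopy 𝓕
  isFanoCopy copy = point , point-injective , λ T → mk⇔
    (toTriples ∘ Equivalence.to (∈𝓕⇔line T)) (Equivalence.from (∈𝓕⇔line T) ∘ fromTriples)
    where
    open Blocking uniform intersecting copy fanoBlocking
    image-tripleOf : ∀ L → image point (tripleOf L) ≡ imageTriple point L
    image-tripleOf (a , b , c) = image-triple point {a = a} {b = b} {c = c}
    toTriples : ∀ {T} → Any (λ L → T ≡ image point L) fano → Any (λ L → T ≡ imageTriple point L) fanoLines
    toTriples = Any.map (λ {L} T≡ → trans T≡ (image-tripleOf L)) ∘ Any.map⁻ {f = tripleOf}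
    fromTriples : ∀ {T} → Any (λ L → T ≡ imageTriple point L) fanoLines → Any (λ L → T ≡ image point L) fano
    fromTriples = Any.map⁺ {f = tripleOf} ∘ Any.map (λ {L} T≡ → trans T≡ (sym (image-tripleOf L)))

  six⇒β≤2 : Copy 𝓕 sixLines → β 0 2 𝓕 ≤ 2
  six⇒β≤2 copy = forcedPair⇒β≤2 {i = # 0} {# 1} (λ ())
    (triple (# 2) (# 3) (# 4)) (triple (# 2) (# 3) (# 5)) (λ ()) lines∈𝓕
    where
    open Copy copy
    open Forcing uniform intersecting point-injective

  fano⇒β≤2 : Copy 𝓕 fano → β 0 2 𝓕 ≤ 2
  fano⇒β≤2 copy = forcedPair⇒β≤2 {i = # 0} {# 1} (λ ())
    (triple (# 2) (# 3) (# 4)) (triple (# 2) (# 5) (# 6)) (λ ()) lines∈𝓕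
    where
    open Copy copy
    open Forcing uniform intersecting point-injective

  module _ (twice : AvoidedTwice 𝓕) {z₀ z₁ : Fin n} (z₀≢z₁ : z₀ ≢ z₁) where

    open Derivation uniform intersecting twice

    classification : IsFanoCopy 𝓕 ⊎ IsSixType 𝓕
    classification = [ inj₂ ∘ isSixType , inj₁ ∘ isFanoCopy ]′ (sixOrFano z₀≢z₁)

    minimalCover⇔member : ∀ C → MinimalCover 𝓕 C ⇔ C ∈𝓕 𝓕
    minimalCover⇔member =
      [ (λ copy → Blocking.minimalCover⇔member uniform intersecting copy sixBlocking twice)
      , (λ copy → Blocking.minimalCover⇔member uniform intersecting copy fanoBlocking twice)
      ]′ (sixOrFano z₀≢z₁)

    avoidedTwice⇒β≤2 : β 0 2 𝓕 ≤ 2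
    avoidedTwice⇒β≤2 = [ six⇒β≤2 , fano⇒β≤2 ]′ (sixOrFano z₀≢z₁)

β≤2 : ∀ {𝓕 : Family n} → Uniform 3 𝓕 → Intersecting 𝓕 → ∀ {z₀ z₁ : Fin n} → z₀ ≢ z₁ → β 0 2 𝓕 ≤ 2
β≤2 {𝓕 = 𝓕} uniform intersecting z₀≢z₁ with 2 ℕ.≤? β 0 2 𝓕
... | yes 2≤β = avoidedTwice⇒β≤2 uniform intersecting (2≤β⇒avoidedTwice 2≤β) z₀≢z₁
... | no 2≰β = <⇒≤ (≰⇒> 2≰β)

sixFamily : (Fin 6 → Fin n) → Family n
sixFamily σ T = does (T ∈ˢ? map (image σ) sixLines)

module _ {σ : Fin 6 → Fin n} (σ-injective : Injective _≡_ _≡_ σ) where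

  ∈sixFamily⁻ : ∀ {T} → T ∈𝓕 sixFamily σ → ∃ λ L → L ∈ˡ sixLines × T ≡ image σ L
  ∈sixFamily⁻ {T} T∈ = find (Any.map⁻ (from-does (T ∈ˢ? map (image σ) sixLines) T∈))

  sixFamily-uniform : Uniform 3 (sixFamily σ)
  sixFamily-uniform T T∈ = onLine (∈sixFamily⁻ {T} T∈)
    where
    onLine : (∃ λ L → L ∈ˡ sixLines × T ≡ image σ L) → ∣ T ∣ ≡ 3
    onLine (L , L∈ , T≡L) = trans (cong ∣_∣ T≡L) (trans (∣image∣≡∣∣ σ-injective L) (All.lookup sixTriples L∈))

  images-meet : ∀ {L₁ L₂} → L₁ ∈ˡ sixLines → L₂ ∈ˡ sixLines → Nonempty (image σ L₁ ∩ image σ L₂)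
  images-meet {L₁} {L₂} L₁∈ L₂∈ with All.lookup (All.lookup sixIntersecting L₁∈) L₂∈
  ... | x , x∈ with x∈p∩q⁻ L₁ L₂ x∈
  ... | x∈L₁ , x∈L₂ = σ x , x∈p∩q⁺ (∈-image⁺ σ x∈L₁ , ∈-image⁺ σ x∈L₂)

  sixFamily-intersecting : Intersecting (sixFamily σ)
  sixFamily-intersecting F G F∈ G∈ = meet (∈sixFamily⁻ {F} F∈) (∈sixFamily⁻ {G} G∈)
    where
    meet : (∃ λ L → L ∈ˡ sixLines × F ≡ image σ L) → (∃ λ L → L ∈ˡ sixLines × G ≡ image σ L) → Nonempty (F ∩ G)
    meet (L₁ , L₁∈ , F≡L₁) (L₂ , L₂∈ , G≡L₂) =
      subst₂ (λ A B → Nonempty (A ∩ B)) (sym F≡L₁) (sym G≡L₂) (images-meet L₁∈ L₂∈)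

  sixFamily-avoidedTwice : AvoidedTwice (sixFamily σ)
  sixFamily-avoidedTwice {a} {b} a≢b with find (sixAvoidedTwice B ∣B∣≤2)
    where
    B : Subset 6
    B = preimage σ (pair a b)
    ∣B∣≤2 : ∣ B ∣ ≤ 2
    ∣B∣≤2 = subst (∣ B ∣ ≤_) (∣pair∣≡2 a≢b) (∣preimage∣≤∣∣ σ-injective (pair a b))
  ... | L₁ , L₁∈ , avoided with find avoided
  ... | L₂ , L₂∈ , L₁≢L₂ , ∅₁ , ∅₂ =
    image σ L₁ , image σ L₂ , L₁≢L₂ ∘ image-injective σ-injective , avoider L₁∈ ∅₁ , avoider L₂∈ ∅₂
    where
    avoider : ∀ {L} → L ∈ˡ sixLines → Empty (preimage σ (pair a b) ∩ L) → Avoider (sixFamily σ) a b (image σ L)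
    avoider {L} L∈ ∅ =
      dec-true (image σ L ∈ˢ? map (image σ) sixLines) (∈-map⁺ (image σ) L∈) , missed a∈pair , missed b∈pair
      where
      missed : ∀ {x} → x ∈ pair a b → x ∉ image σ L
      missed x∈ab x∈L with ∈-image⁻ σ x∈L
      ... | y , y∈L , refl = ∅ (y , x∈p∩q⁺ (∈-preimage⁺ σ x∈ab , y∈L))

  β-sixFamily : β 0 2 (sixFamily σ) ≡ 2
  β-sixFamily = ≤-antisym
    (β≤2 sixFamily-uniform sixFamily-intersecting σ₀≢σ₁)
    (avoidedTwice⇒2≤β σ₀≢σ₁ sixFamily-avoidedTwice)
    where
    σ₀≢σ₁ : σ (# 0) ≢ σ (# 1)
    σ₀≢σ₁ = (λ ()) ∘ σ-injective

lemma2p2 : (n : ℕ) → n ≥ 6 →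
    βnk≡ n 3 0 2 2 ×
    (∀ (𝓕 : Family n) → Uniform 3 𝓕 → Intersecting 𝓕 → β 0 2 𝓕 ≡ 2 →
    (IsFanoCopy 𝓕 ⊎ IsSixType 𝓕) ×
    (∀ C → MinimalCover 𝓕 C ⇔ C ∈𝓕 𝓕))
lemma2p2 n n≥6 =
  ( (sixFamily σ , sixFamily-uniform σ-injective , sixFamily-intersecting σ-injective , β-sixFamily σ-injective)
  , λ 𝓕 uniform intersecting → β≤2 uniform intersecting σ₀≢σ₁ ) ,
  λ 𝓕 uniform intersecting β≡2 →
    let twice = 2≤β⇒avoidedTwice (≤-reflexive (sym β≡2)) in
    classification uniform intersecting twice σ₀≢σ₁ , minimalCover⇔member uniform intersecting twice σ₀≢σ₁
  where
  σ : Fin 6 → Fin n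
  σ i = inject≤ i n≥6
  σ-injective : Injective _≡_ _≡_ σ
  σ-injective = inject≤-injective n≥6 n≥6 _ _
  σ₀≢σ₁ : σ (# 0) ≢ σ (# 1)
  σ₀≢σ₁ = (λ ()) ∘ σ-injective
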